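{- Let $F$ be an isonemal fabric whose warps and wefts are coloured by thin (respectively thick) striping with $c$ colours, the set of warp colours being equal to the set of weft colours, and suppose the colouring is perfect. Then the redundant cells (respectively blocks) are the dark cells (respectively dark blocks) of a derived isonemal fabric of order $c$ (respectively a doubled order-$c$ isonemal fabric, of order $2c$) having one (respectively two) dark cells per order length $c$ (respectively $2c$).
   Context: Cells are unit squares $[i,i+1]\times[j,j+1]$ tessellating the plane; vertical strips are warps, horizontal strips are wefts. A prefabric assigns to each cell which crossing strand is on top; its design colours a cell dark if the warp is on top and pale otherwise; a fabric does not fall apart. With $\tau$ reflection in the plane of the fabric, the symmetry group $G_1$ consists of pairs $(t,r)$, $t$ a plane isometry preserving the cell tessellation and $r\in\{e,\tau\}$, with $t$ mapping the over/under relation to itself ($r=e$) or its reverse ($r=\tau$). Isonemal: periodic with $G_1$ transitive on all strands. Order: the period of the design along a strand. Thin striping colours each strand; thick striping colours adjacent pairs of strands $[2a,2a+2]$, and a block is a square $[2a,2a+2]\times[2b,2b+2]$ where a warp pair crosses a weft pair. A redundant cell (block) is one where a warp (pair) and a weft (pair) of the same colour cross. A doubled design is obtained by replacing each cell of a design by a $2\times2$ block of the same colour. An element $(t,r)\in G_1$ is a colour symmetry if for each colour $t$ maps all strands of that colour onto strands of one common colour; the colouring is perfect if every element of $G_1$ is a colour symmetry. -}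

module Defs where

open import Data.Bool using (Bool; true; false; not; _xor_; if_then_else_)
open import Data.Nat as ℕ using (ℕ; zero; suc)
open import Data.Integer using (ℤ; +_; _+_; _-_; _*_; _/ℕ_)
open import Data.Product using (Σ; ∃; _×_; _,_)
open import Relation.Binary.PropositionalEquality using (_≡_; _≢_)
open import Relation.Nullary using (¬_)
open import Relation.Nullary.Decidable using (⌊_⌋)
open import Function.Bundles using (_⇔_)

-- Cells and strands.
-- Cell (i , j) is the unit square [i,i+1]×[j,j+1]; warp i is the
-- vertical strip [i,i+1]×ℝ, weft j the horizontal strip ℝ×[j,j+1].
-- At cell (i , j) warp i crosses weft j.

-- A prefabric: P i j = true  iff warp i is on top of weft j at cell (i,j).
-- Its design: cell (i,j) is dark iff P i j = true.
Prefabric : Set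
Prefabric = ℤ → ℤ → Bool

data Strand : Set where
  warp : ℤ → Strand
  weft : ℤ → Strand

-- Plane isometries preserving the cell tessellation.
-- On cell indices every such isometry acts as
--   (i , j) ↦ (f₁ i , f₂ j)   or   (i , j) ↦ (f₁ j , f₂ i)   (swap)
-- where fₖ x = bₖ + x  or  fₖ x = bₖ - x  (negₖ), bₖ ∈ ℤ.
-- (E.g. the reflection x ↦ -x sends [i,i+1] to [-i-1,-i].)
-- These are exactly the 8 point symmetries of the square lattice
-- combined with all lattice-compatible translations.

record Isom : Set where
  constructor isom
  field
    swap : Bool
    neg₁ : Bool
    neg₂ : Bool
    b₁   : ℤ
    b₂   : ℤ

aff : Bool → ℤ → ℤ → ℤ
aff true  b x = b - x
aff false b x = b + x

cellMap : Isom → ℤ → ℤ → ℤ × ℤ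
cellMap (isom false n₁ n₂ b₁ b₂) i j = aff n₁ b₁ i , aff n₂ b₂ j
cellMap (isom true  n₁ n₂ b₁ b₂) i j = aff n₁ b₁ j , aff n₂ b₂ i

strandMap : Isom → Strand → Strand
strandMap (isom false n₁ n₂ b₁ b₂) (warp i) = warp (aff n₁ b₁ i)
strandMap (isom false n₁ n₂ b₁ b₂) (weft j) = weft (aff n₂ b₂ j)
strandMap (isom true  n₁ n₂ b₁ b₂) (warp i) = weft (aff n₂ b₂ i)
strandMap (isom true  n₁ n₂ b₁ b₂) (weft j) = warp (aff n₁ b₁ j)

isSwap : Isom → Bool
isSwap t = Isom.swap t

at : Prefabric → ℤ × ℤ → Bool
at P (i , j) = P i j

-- (t , r) ∈ G₁(P).  r = false is e, r = true is τ.
-- t maps the strand on top at (i,j) to the strand on top at t(i,j)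
-- (r = e), resp. to the strand underneath (r = τ).  Since t maps warps
-- to wefts exactly when it swaps, this reads:
InG1 : Prefabric → Isom → Bool → Set
InG1 P t r = ∀ i j → at P (cellMap t i j) ≡ ((P i j xor isSwap t) xor r)

PeriodicWith : Prefabric → ℕ → Set
PeriodicWith P n = ∀ i j → (P i (j + + n) ≡ P i j) × (P (i + + n) j ≡ P i j)

Periodic : Prefabric → Set
Periodic P = ∃ λ n → (0 ℕ.< n) × PeriodicWith P n

HasOrder : Prefabric → ℕ → Set
HasOrder P n = (0 ℕ.< n) × PeriodicWith P n
             × (∀ m → 0 ℕ.< m → m ℕ.< n → ¬ PeriodicWith P m)

Isonemal : Prefabric → Set
Isonemal P = Periodic P
           × (∀ s s′ → ∃ λ t → ∃ λ r → InG1 P t r × (strandMap t s ≡ s′))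

FallsApart : Prefabric → Set
FallsApart P = ∃ λ (S : Strand → Bool) →
    (∃ λ s → S s ≡ true) × (∃ λ s → S s ≡ false)
  × (∀ i j → (S (warp i) ≡ true → S (weft j) ≡ false → P i j ≡ true)
           × (S (warp i) ≡ false → S (weft j) ≡ true → P i j ≡ false))

Fabric : Prefabric → Set
Fabric P = ¬ FallsApart P

b2n : Bool → ℕ
b2n true  = 1
b2n false = 0

countWarp : Prefabric → ℤ → ℤ → ℕ → ℕ
countWarp P i j zero    = 0
countWarp P i j (suc k) = b2n (P i (j + + k)) ℕ.+ countWarp P i j k

countWeft : Prefabric → ℤ → ℤ → ℕ → ℕ
countWeft P i j zero    = 0
countWeft P i j (suc k) = b2n (P (i + + k) j) ℕ.+ countWeft P i j k

DarkPer : Prefabric → ℕ → ℕ → Set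
DarkPer P d n = ∀ i j → (countWarp P i j n ≡ d) × (countWeft P i j n ≡ d)

colour : (ℤ → ℕ) → (ℤ → ℕ) → Strand → ℕ
colour wc wf (warp i) = wc i
colour wc wf (weft j) = wf j

ThinStriping : ℕ → (ℤ → ℕ) → Set
ThinStriping c f = (∀ i → f (i + + c) ≡ f i)
                 × (∀ i k → 0 ℕ.< k → k ℕ.< c → f (i + + k) ≢ f i)

ThickStriping : ℕ → (ℤ → ℕ) → Set
ThickStriping c f = (∀ a → f (+ 2 * a + + 1) ≡ f (+ 2 * a))
                  × (∀ i → f (i + + (2 ℕ.* c)) ≡ f i)
                  × (∀ a k → 0 ℕ.< k → k ℕ.< c
                       → f (+ 2 * a + + (2 ℕ.* k)) ≢ f (+ 2 * a))

SameColourSet : (ℤ → ℕ) → (ℤ → ℕ) → Set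
SameColourSet wc wf = ∀ k → (∃ λ i → wc i ≡ k) ⇔ (∃ λ j → wf j ≡ k)

ColourSymmetry : (Strand → ℕ) → Isom → Set
ColourSymmetry col t = ∀ k → ∃ λ k′ → ∀ s → col s ≡ k → col (strandMap t s) ≡ k′

Perfect : Prefabric → (Strand → ℕ) → Set
Perfect P col = ∀ t r → InG1 P t r → ColourSymmetry col t

redundantCells : (ℤ → ℕ) → (ℤ → ℕ) → Prefabric
redundantCells wc wf i j = ⌊ wc i ℕ.≟ wf j ⌋

-- design on blocks: block (a , b) = [2a,2a+2]×[2b,2b+2] dark iff redundant
redundantBlocks : (ℤ → ℕ) → (ℤ → ℕ) → Prefabric
redundantBlocks wc wf a b = ⌊ wc (+ 2 * a) ℕ.≟ wf (+ 2 * b) ⌋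

double : Prefabric → Prefabric
double E i j = E (i /ℕ 2) (j /ℕ 2)

-- Perfection makes every
-- symmetry (t, r) of F preserve and (via its inverse) reflect equality of colours, so t maps
-- redundant cells to redundant cells and (t, e) or (t, τ), according as t keeps or swaps warps
-- and wefts, is a symmetry of the redundant design; transitivity on strands is inherited from F.
-- Along warp i the redundant cells are its crossings with the wefts of colour wc i, which occur
-- exactly once in every c consecutive wefts: this gives order c and one dark cell per c cells.
-- The design hangs together because a lifted-off set containing a warp contains every weft of
-- another colour; adjacent warps differ in colour, so it contains all wefts, hence all warps.
--
-- Under thick striping a colour-preserving isometry maps pairs of strands to pairs, since
-- adjacent strands of different pairs differ in colour; so it halves to a symmetry of the block
-- design, which is the thin design of the colourings a ↦ wc (2a) and a ↦ wf (2a), and whose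
-- double is the design of redundant cells.  Doubling turns order c ≥ 2 into order 2c: an even
-- period 2q of the double makes q a period, an odd one makes 1 a period.

module Submission where

open import Defs
open import Data.Nat using (ℕ; _≤_; _*_)
open import Data.Integer using (ℤ)
open import Data.Product using (_×_)

open import Data.Bool using (Bool; true; false; _xor_)
open import Data.Bool.Properties using (T-≡; ¬-not; xor-assoc; xor-same; xor-identityʳ)
open import Data.Integer as ℤ
  using (+_; -[1+_]; _-_; -_; _/ℕ_; _%ℕ_; +≤+; +<+) renaming (_+_ to _⊕_; _*_ to _⊗_; suc to sucℤ)
import Data.Integer.DivMod as ℤ
import Data.Integer.Properties as ℤ
open import Data.Integer.Tactic.RingSolver using (solve-∀)
open import Data.Nat as ℕ using (zero; suc; _+_; _<_; z≤n; s≤s; NonZero)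
import Data.Nat.Properties as ℕ
open import Data.Nat.Tactic.RingSolver using () renaming (solve-∀ to ℕ-solve-∀)
open import Data.Product using (∃; _,_; proj₁; proj₂; map; uncurry)
open import Function using (_∘_; flip; case_of_)
open import Function.Bundles using (_⇔_; mk⇔; Equivalence)
open import Function.Properties.Equivalence using () renaming (trans to ⇔-trans; sym to ⇔-sym)
open import Relation.Binary.PropositionalEquality
open import Relation.Nullary using (¬_; contradiction; yes; no)
open import Relation.Nullary.Decidable using (⌊_⌋; toWitness; fromWitness; isYes≗does; does-⇔)

open Equivalence using (to; from)
open import Algebra.Properties.CommutativeSemigroup ℕ.+-commutativeSemigroup using (x∙yz≈y∙xz)

⌊≟⌋≡true⇔≡ : ∀ {m n} → ⌊ m ℕ.≟ n ⌋ ≡ true ⇔ m ≡ n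
⌊≟⌋≡true⇔≡ = mk⇔ (toWitness ∘ from T-≡) (to T-≡ ∘ fromWitness)

⌊≟⌋-cong : ∀ {m n m′ n′} → m ≡ n ⇔ m′ ≡ n′ → ⌊ m ℕ.≟ n ⌋ ≡ ⌊ m′ ℕ.≟ n′ ⌋
⌊≟⌋-cong {m} {n} {m′} {n′} m≡n⇔m′≡n′ = begin
  ⌊ m ℕ.≟ n ⌋      ≡⟨ isYes≗does (m ℕ.≟ n) ⟩
  _                ≡⟨ does-⇔ m≡n⇔m′≡n′ (m ℕ.≟ n) (m′ ℕ.≟ n′) ⟩
  _                ≡⟨ isYes≗does (m′ ℕ.≟ n′) ⟨
  ⌊ m′ ℕ.≟ n′ ⌋    ∎
  where open ≡-Reasoning

≡true-ext : ∀ {x y} → x ≡ true ⇔ y ≡ true → x ≡ y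
≡true-ext {true}          x⇔y = sym (to x⇔y refl)
≡true-ext {false} {true}  x⇔y = from x⇔y refl
≡true-ext {false} {false} _   = refl

b2n-injective : ∀ {x y} → b2n x ≡ b2n y → x ≡ y
b2n-injective {true}  {true}  _ = refl
b2n-injective {false} {false} _ = refl

xor-cancelʳ : ∀ x y → (x xor y) xor y ≡ x
xor-cancelʳ x y = begin
  (x xor y) xor y  ≡⟨ xor-assoc x y y ⟩
  x xor (y xor y)  ≡⟨ cong (x xor_) (xor-same y) ⟩
  x xor false      ≡⟨ xor-identityʳ x ⟩
  x                ∎
  where open ≡-Reasoning

-- Halving integers

halve : ℤ → ℤ
halve x = x /ℕ 2

/ℕ-unique : ∀ n d q .{{_ : NonZero d}} → q ⊗ + d ℤ.≤ n → n ℤ.< sucℤ q ⊗ + d → n /ℕ d ≡ q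
/ℕ-unique n d q lower upper =
  ℤ.≤-antisym (≤-of (ℤ.[n/ℕd]*d≤n n d) upper) (≤-of lower (ℤ.n<s[n/ℕd]*d n d))
  where
  ≤-of : ∀ {a b} → a ⊗ + d ℤ.≤ n → n ℤ.< sucℤ b ⊗ + d → a ℤ.≤ b
  ≤-of {a} {b} ad≤n n<[1+b]d = subst (a ℤ.≤_) (ℤ.pred-suc b)
    (ℤ.i<j⇒i≤pred[j] (ℤ.*-cancelʳ-<-nonNeg {a} {sucℤ b} (+ d) (ℤ.≤-<-trans ad≤n n<[1+b]d)))

halve-2a+r : ∀ a r → r < 2 → halve (+ 2 ⊗ a ⊕ + r) ≡ a
halve-2a+r a r r<2 = /ℕ-unique (+ 2 ⊗ a ⊕ + r) 2 a
  (subst (ℤ._≤ + 2 ⊗ a ⊕ + r) (2a+0≡a*2 a) (ℤ.+-monoʳ-≤ (+ 2 ⊗ a) (+≤+ z≤n)))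
  (subst (+ 2 ⊗ a ⊕ + r ℤ.<_) (2a+2≡[1+a]*2 a) (ℤ.+-monoʳ-< (+ 2 ⊗ a) (+<+ r<2)))
  where
  2a+0≡a*2 : ∀ a → + 2 ⊗ a ⊕ + 0 ≡ a ⊗ + 2
  2a+0≡a*2 = solve-∀
  2a+2≡[1+a]*2 : ∀ a → + 2 ⊗ a ⊕ + 2 ≡ (+ 1 ⊕ a) ⊗ + 2
  2a+2≡[1+a]*2 = solve-∀

halve-even : ∀ a → halve (+ 2 ⊗ a) ≡ a
halve-even a = trans (cong halve (sym (ℤ.+-identityʳ (+ 2 ⊗ a)))) (halve-2a+r a 0 (s≤s z≤n))

halve-odd : ∀ a → halve (+ 2 ⊗ a ⊕ + 1) ≡ a
halve-odd a = halve-2a+r a 1 (s≤s (s≤s z≤n))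

data Parity : ℤ → Set where
  even : ∀ a → Parity (+ 2 ⊗ a)
  odd  : ∀ a → Parity (+ 2 ⊗ a ⊕ + 1)

parity : ∀ x → Parity x
parity x = subst Parity (sym x≡2q+r) (by-remainder (x %ℕ 2) (ℤ.n%ℕd<d x 2))
  where
  q : ℤ
  q = halve x
  r+q*2≡2q+r : ∀ r q → r ⊕ q ⊗ + 2 ≡ + 2 ⊗ q ⊕ r
  r+q*2≡2q+r = solve-∀
  x≡2q+r : x ≡ + 2 ⊗ q ⊕ + (x %ℕ 2)
  x≡2q+r = trans (ℤ.a≡a%ℕn+[a/ℕn]*n x 2) (r+q*2≡2q+r (+ (x %ℕ 2)) q)
  by-remainder : ∀ r → r < 2 → Parity (+ 2 ⊗ q ⊕ + r)
  by-remainder 0 _ = subst Parity (sym (ℤ.+-identityʳ (+ 2 ⊗ q))) (even q)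
  by-remainder 1 _ = odd q
  by-remainder (suc (suc _)) (s≤s (s≤s ()))

data ℕParity : ℕ → Set where
  even : ∀ q → ℕParity (q * 2)
  odd  : ∀ q → ℕParity (suc (q * 2))

ℕparity : ∀ m → ℕParity m
ℕparity zero = even 0
ℕparity (suc m) with ℕparity m
... | even q = odd q
... | odd q  = even (suc q)

halve-shift : ∀ k x → halve (+ 2 ⊗ k ⊕ x) ≡ k ⊕ halve x
halve-shift k x with parity x
... | even a = begin
  halve (+ 2 ⊗ k ⊕ + 2 ⊗ a)  ≡⟨ cong halve (2k+2a≡2[k+a] k a) ⟩
  halve (+ 2 ⊗ (k ⊕ a))       ≡⟨ halve-even (k ⊕ a) ⟩
  k ⊕ a                       ≡⟨ cong (k ⊕_) (halve-even a) ⟨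
  k ⊕ halve (+ 2 ⊗ a)         ∎
  where
  open ≡-Reasoning
  2k+2a≡2[k+a] : ∀ k a → + 2 ⊗ k ⊕ + 2 ⊗ a ≡ + 2 ⊗ (k ⊕ a)
  2k+2a≡2[k+a] = solve-∀
... | odd a = begin
  halve (+ 2 ⊗ k ⊕ (+ 2 ⊗ a ⊕ + 1))  ≡⟨ cong halve (2k+[2a+1]≡2[k+a]+1 k a) ⟩
  halve (+ 2 ⊗ (k ⊕ a) ⊕ + 1)         ≡⟨ halve-odd (k ⊕ a) ⟩
  k ⊕ a                               ≡⟨ cong (k ⊕_) (halve-odd a) ⟨
  k ⊕ halve (+ 2 ⊗ a ⊕ + 1)           ∎
  where
  open ≡-Reasoning
  2k+[2a+1]≡2[k+a]+1 : ∀ k a → + 2 ⊗ k ⊕ (+ 2 ⊗ a ⊕ + 1) ≡ + 2 ⊗ (k ⊕ a) ⊕ + 1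
  2k+[2a+1]≡2[k+a]+1 = solve-∀

halve-reflect : ∀ b x → halve (+ 2 ⊗ b ⊕ + 1 - x) ≡ b - halve x
halve-reflect b x with parity x
... | even a = begin
  halve (+ 2 ⊗ b ⊕ + 1 - + 2 ⊗ a)  ≡⟨ cong halve (2b+1-2a≡2[b-a]+1 b a) ⟩
  halve (+ 2 ⊗ (b - a) ⊕ + 1)       ≡⟨ halve-odd (b - a) ⟩
  b - a                             ≡⟨ cong (_-_ b) (halve-even a) ⟨
  b - halve (+ 2 ⊗ a)               ∎
  where
  open ≡-Reasoning
  2b+1-2a≡2[b-a]+1 : ∀ b a → + 2 ⊗ b ⊕ + 1 - + 2 ⊗ a ≡ + 2 ⊗ (b - a) ⊕ + 1
  2b+1-2a≡2[b-a]+1 = solve-∀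
... | odd a = begin
  halve (+ 2 ⊗ b ⊕ + 1 - (+ 2 ⊗ a ⊕ + 1))  ≡⟨ cong halve (2b+1-[2a+1]≡2[b-a] b a) ⟩
  halve (+ 2 ⊗ (b - a))                     ≡⟨ halve-even (b - a) ⟩
  b - a                                     ≡⟨ cong (_-_ b) (halve-odd a) ⟨
  b - halve (+ 2 ⊗ a ⊕ + 1)                 ∎
  where
  open ≡-Reasoning
  2b+1-[2a+1]≡2[b-a] : ∀ b a → + 2 ⊗ b ⊕ + 1 - (+ 2 ⊗ a ⊕ + 1) ≡ + 2 ⊗ (b - a)
  2b+1-[2a+1]≡2[b-a] = solve-∀

-- Periods and dark-cell counts along a single strand

_HasPeriod_ : (ℤ → Bool) → ℕ → Set
ρ HasPeriod n = ∀ y → ρ (y ⊕ + n) ≡ ρ y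

count : (ℤ → Bool) → ℤ → ℕ → ℕ
count ρ j zero    = 0
count ρ j (suc k) = b2n (ρ (j ⊕ + k)) + count ρ j k

countWarp≡count : ∀ P i j n → countWarp P i j n ≡ count (P i) j n
countWarp≡count P i j zero    = refl
countWarp≡count P i j (suc n) = cong (_+_ (b2n (P i (j ⊕ + n)))) (countWarp≡count P i j n)

countWeft≡count : ∀ P i j n → countWeft P i j n ≡ count (flip P j) i n
countWeft≡count P i j zero    = refl
countWeft≡count P i j (suc n) = cong (_+_ (b2n (P (i ⊕ + n) j))) (countWeft≡count P i j n)

count-slide : ∀ ρ j n → count ρ j (suc n) ≡ b2n (ρ j) + count ρ (j ⊕ + 1) n
count-slide ρ j zero    = cong (λ y → b2n (ρ y) + 0) (ℤ.+-identityʳ j)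
count-slide ρ j (suc n) = begin
  b2n (ρ (j ⊕ + suc n)) + count ρ j (suc n)
    ≡⟨ cong₂ (λ y c → b2n (ρ y) + c) (sym (ℤ.+-assoc j (+ 1) (+ n))) (count-slide ρ j n) ⟩
  b2n (ρ (j ⊕ + 1 ⊕ + n)) + (b2n (ρ j) + count ρ (j ⊕ + 1) n)
    ≡⟨ x∙yz≈y∙xz (b2n (ρ (j ⊕ + 1 ⊕ + n))) (b2n (ρ j)) (count ρ (j ⊕ + 1) n) ⟩
  b2n (ρ j) + count ρ (j ⊕ + 1) (suc n)
    ∎
  where open ≡-Reasoning

count-shift : ∀ {ρ n} → ρ HasPeriod n → ∀ j → count ρ (j ⊕ + 1) n ≡ count ρ j n
count-shift {ρ} {n} per j = ℕ.+-cancelˡ-≡ (b2n (ρ j)) _ _ (begin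
  b2n (ρ j) + count ρ (j ⊕ + 1) n  ≡⟨ count-slide ρ j n ⟨
  count ρ j (suc n)                ≡⟨ cong (λ b → b2n b + count ρ j n) (per j) ⟩
  b2n (ρ j) + count ρ j n          ∎)
  where open ≡-Reasoning

step-invariant⇒constant : ∀ {A : Set} (f : ℤ → A) → (∀ j → f (j ⊕ + 1) ≡ f j) → ∀ j → f j ≡ f (+ 0)
step-invariant⇒constant f step (+ zero)      = refl
step-invariant⇒constant f step (+ suc n)     =
  trans (cong (f ∘ +_) (ℕ.+-comm 1 n)) (trans (step (+ n)) (step-invariant⇒constant f step (+ n)))
step-invariant⇒constant f step -[1+ zero ]   = sym (step -[1+ zero ])
step-invariant⇒constant f step -[1+ suc n ]  =
  trans (sym (step -[1+ suc n ])) (step-invariant⇒constant f step -[1+ n ])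

count-shift-invariant : ∀ {ρ n} → ρ HasPeriod n → ∀ j j′ → count ρ j n ≡ count ρ j′ n
count-shift-invariant {ρ} {n} per j j′ = trans (count≡count₀ j) (sym (count≡count₀ j′))
  where
  count≡count₀ : ∀ j → count ρ j n ≡ count ρ (+ 0) n
  count≡count₀ = step-invariant⇒constant (λ j → count ρ j n) (count-shift per)

constant-count⇒period : ∀ {ρ n d} → (∀ j → count ρ j n ≡ d) → ρ HasPeriod n
constant-count⇒period {ρ} {n} {d} count≡d j = b2n-injective (ℕ.+-cancelʳ-≡ d _ _ (begin
  b2n (ρ (j ⊕ + n)) + d            ≡⟨ cong (_+_ (b2n (ρ (j ⊕ + n)))) (count≡d j) ⟨
  count ρ j (suc n)                ≡⟨ count-slide ρ j n ⟩
  b2n (ρ j) + count ρ (j ⊕ + 1) n  ≡⟨ cong (_+_ (b2n (ρ j))) (count≡d (j ⊕ + 1)) ⟩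
  b2n (ρ j) + d                    ∎))
  where open ≡-Reasoning

count-single : ∀ {ρ y} n → ρ y ≡ true → (∀ k → 0 < k → k < suc n → ρ (y ⊕ + k) ≡ false) →
               count ρ y (suc n) ≡ 1
count-single {ρ} {y} zero    ρy _ = cong (λ b → b2n b + 0) (trans (cong ρ (ℤ.+-identityʳ y)) ρy)
count-single {ρ} {y} (suc n) ρy others =
  cong₂ (λ b c → b2n b + c) (others (suc n) (s≤s z≤n) ℕ.≤-refl)
    (count-single n ρy (λ k 0<k k<n → others k 0<k (ℕ.m<n⇒m<1+n k<n)))

periodicWith : ∀ {P n} → (∀ i → P i HasPeriod n) → (∀ j → flip P j HasPeriod n) → PeriodicWith P n
periodicWith rows cols i j = rows i j , cols j i

periodicWith-rows : ∀ {P n} → PeriodicWith P n → ∀ i → P i HasPeriod n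
periodicWith-rows per i j = proj₁ (per i j)

periodicWith-cols : ∀ {P n} → PeriodicWith P n → ∀ j → flip P j HasPeriod n
periodicWith-cols per j i = proj₂ (per i j)

darkPer : ∀ {P d n} → (∀ i j → count (P i) j n ≡ d) → (∀ j i → count (flip P j) i n ≡ d) →
          DarkPer P d n
darkPer {P} {d} {n} rows cols i j =
  trans (countWarp≡count P i j n) (rows i j) , trans (countWeft≡count P i j n) (cols j i)

darkPer-rows : ∀ {P d n} → DarkPer P d n → ∀ i j → count (P i) j n ≡ d
darkPer-rows {P} {d} {n} dark i j = trans (sym (countWarp≡count P i j n)) (proj₁ (dark i j))

darkPer-cols : ∀ {P d n} → DarkPer P d n → ∀ j i → count (flip P j) i n ≡ d
darkPer-cols {P} {d} {n} dark j i = trans (sym (countWeft≡count P i j n)) (proj₂ (dark i j))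

-- Redundant cells under thin striping

IndicatesColour : (ℤ → Bool) → (ℤ → ℕ) → ℕ → Set
IndicatesColour ρ g k = ∀ y → ρ y ≡ true ⇔ g y ≡ k

module _ {ρ g k c} (striped : ThinStriping c g) (indicates : IndicatesColour ρ g k) where

  indicator-period : ρ HasPeriod c
  indicator-period y = ≡true-ext (mk⇔
    (λ ρy+c → from (indicates y) (trans (sym (proj₁ striped y)) (to (indicates (y ⊕ + c)) ρy+c)))
    (λ ρy → from (indicates (y ⊕ + c)) (trans (proj₁ striped y) (to (indicates y) ρy))))

  indicator-count : 0 < c → ∃ (λ y → g y ≡ k) → ∀ j → count ρ j c ≡ 1
  indicator-count (s≤s {n = n} _) (y , gy≡k) j =
    trans (count-shift-invariant indicator-period j y)
      (count-single n (from (indicates y) gy≡k) others)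
    where
    others : ∀ m → 0 < m → m < suc n → ρ (y ⊕ + m) ≡ false
    others m 0<m m<c = ¬-not λ ρy+m →
      proj₂ striped y m 0<m m<c (trans (to (indicates (y ⊕ + m)) ρy+m) (sym gy≡k))

  indicator-aperiodic : ∃ (λ y → g y ≡ k) → ∀ m → 0 < m → m < c → ¬ ρ HasPeriod m
  indicator-aperiodic (y , gy≡k) m 0<m m<c per = proj₂ striped y m 0<m m<c
    (trans (to (indicates (y ⊕ + m)) (trans (per y) (from (indicates y) gy≡k))) (sym gy≡k))

module _ {wc wf : ℤ → ℕ} where

  redundantCells-row : ∀ i → IndicatesColour (redundantCells wc wf i) wf (wc i)
  redundantCells-row i y = mk⇔ (sym ∘ to ⌊≟⌋≡true⇔≡) (from ⌊≟⌋≡true⇔≡ ∘ sym)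

  redundantCells-col : ∀ j → IndicatesColour (flip (redundantCells wc wf) j) wc (wf j)
  redundantCells-col j x = ⌊≟⌋≡true⇔≡

  module _ {c} (wc-striped : ThinStriping c wc) (wf-striped : ThinStriping c wf) where

    redundantCells-periodic : PeriodicWith (redundantCells wc wf) c
    redundantCells-periodic = periodicWith
      (λ i → indicator-period wf-striped (redundantCells-row i))
      (λ j → indicator-period wc-striped (redundantCells-col j))

    module _ (0<c : 0 < c) (same : SameColourSet wc wf) where

      redundantCells-hasOrder : HasOrder (redundantCells wc wf) c
      redundantCells-hasOrder = 0<c , redundantCells-periodic , λ m 0<m m<c per →
        indicator-aperiodic wf-striped (redundantCells-row (+ 0)) (to (same _) (+ 0 , refl))
          m 0<m m<c (periodicWith-rows per (+ 0))

      redundantCells-darkPer : DarkPer (redundantCells wc wf) 1 c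
      redundantCells-darkPer = darkPer {P = redundantCells wc wf} {n = c}
        (λ i → indicator-count wf-striped (redundantCells-row i) 0<c (to (same _) (i , refl)))
        (λ j → indicator-count wc-striped (redundantCells-col j) 0<c (from (same _) (j , refl)))

thin-adjacent-differ : ∀ {c f} → 2 ≤ c → ThinStriping c f → ∀ i → f (i ⊕ + 1) ≢ f i
thin-adjacent-differ 2≤c striped i = proj₂ striped i 1 (s≤s z≤n) 2≤c

redundantCells-fabric : ∀ {wc wf} → (∀ i → wc (i ⊕ + 1) ≢ wc i) → SameColourSet wc wf →
                        Fabric (redundantCells wc wf)
redundantCells-fabric {wc} {wf} adjacent-differ same (S , (s , s∈S) , (s′ , s′∉S) , liftable) =
  case trans (sym (all-strands s′)) s′∉S of λ ()
  where
  weft-over : ∀ i j → S (warp i) ≡ true → wf j ≢ wc i → S (weft j) ≡ true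
  weft-over i j i∈S wfj≢wci = ¬-not λ j∉S →
    wfj≢wci (sym (to ⌊≟⌋≡true⇔≡ (proj₁ (liftable i j) i∈S j∉S)))

  warp-over : ∀ i j → S (weft j) ≡ true → wc i ≡ wf j → S (warp i) ≡ true
  warp-over i j j∈S wci≡wfj = ¬-not λ i∉S →
    case trans (sym (from ⌊≟⌋≡true⇔≡ wci≡wfj)) (proj₂ (liftable i j) i∉S j∈S) of λ ()

  weft-of-colour : ∀ i → ∃ λ j → wf j ≡ wc i
  weft-of-colour i = to (same _) (i , refl)

  warp-of-colour : ∀ j → ∃ λ i → wc i ≡ wf j
  warp-of-colour j = from (same _) (j , refl)

  warp-in-S : ∀ s → S s ≡ true → ∃ λ i → S (warp i) ≡ true
  warp-in-S (warp i) i∈S = i , i∈S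
  warp-in-S (weft j) j∈S = let (i , wci≡wfj) = warp-of-colour j in i , warp-over i j j∈S wci≡wfj

  i₀ : ℤ
  i₀ = proj₁ (warp-in-S s s∈S)

  i₀∈S : S (warp i₀) ≡ true
  i₀∈S = proj₂ (warp-in-S s s∈S)

  i₁∈S : S (warp (i₀ ⊕ + 1)) ≡ true
  i₁∈S = let (j , wfj≡wci₁) = weft-of-colour (i₀ ⊕ + 1) in
    warp-over _ j (weft-over i₀ j i₀∈S (adjacent-differ i₀ ∘ trans (sym wfj≡wci₁))) (sym wfj≡wci₁)

  all-wefts : ∀ j → S (weft j) ≡ true
  all-wefts j with wf j ℕ.≟ wc i₀
  ... | yes wfj≡wci₀ = weft-over _ j i₁∈S λ wfj≡wci₁ →
    adjacent-differ i₀ (trans (sym wfj≡wci₁) wfj≡wci₀)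
  ... | no  wfj≢wci₀ = weft-over i₀ j i₀∈S wfj≢wci₀

  all-strands : ∀ s → S s ≡ true
  all-strands (warp i) =
    let (j , wfj≡wci) = weft-of-colour i in warp-over i j (all-wefts j) (sym wfj≡wci)
  all-strands (weft j) = all-wefts j

-- Symmetries

inverseOffset : Bool → ℤ → ℤ
inverseOffset true  b = b
inverseOffset false b = - b

aff-inverseˡ : ∀ n b x → aff n (inverseOffset n b) (aff n b x) ≡ x
aff-inverseˡ true  b x = b-[b-x]≡x b x
  where
  b-[b-x]≡x : ∀ b x → b - (b - x) ≡ x
  b-[b-x]≡x = solve-∀
aff-inverseˡ false b x = -b+[b+x]≡x b x
  where
  -b+[b+x]≡x : ∀ b x → - b ⊕ (b ⊕ x) ≡ x
  -b+[b+x]≡x = solve-∀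

aff-inverseʳ : ∀ n b x → aff n b (aff n (inverseOffset n b) x) ≡ x
aff-inverseʳ true  b x = aff-inverseˡ true b x
aff-inverseʳ false b x = b+[-b+x]≡x b x
  where
  b+[-b+x]≡x : ∀ b x → b ⊕ (- b ⊕ x) ≡ x
  b+[-b+x]≡x = solve-∀

inverse : Isom → Isom
inverse (isom false n₁ n₂ b₁ b₂) = isom false n₁ n₂ (inverseOffset n₁ b₁) (inverseOffset n₂ b₂)
inverse (isom true  n₁ n₂ b₁ b₂) = isom true  n₂ n₁ (inverseOffset n₂ b₂) (inverseOffset n₁ b₁)

isSwap-inverse : ∀ t → isSwap (inverse t) ≡ isSwap t
isSwap-inverse (isom false _ _ _ _) = refl
isSwap-inverse (isom true  _ _ _ _) = refl

strandMap-inverse : ∀ t s → strandMap (inverse t) (strandMap t s) ≡ s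
strandMap-inverse (isom false n₁ n₂ b₁ b₂) (warp i) = cong warp (aff-inverseˡ n₁ b₁ i)
strandMap-inverse (isom false n₁ n₂ b₁ b₂) (weft j) = cong weft (aff-inverseˡ n₂ b₂ j)
strandMap-inverse (isom true  n₁ n₂ b₁ b₂) (warp i) = cong warp (aff-inverseˡ n₂ b₂ i)
strandMap-inverse (isom true  n₁ n₂ b₁ b₂) (weft j) = cong weft (aff-inverseˡ n₁ b₁ j)

cellMap-inverse : ∀ t u v → uncurry (cellMap t) (cellMap (inverse t) u v) ≡ (u , v)
cellMap-inverse (isom false n₁ n₂ b₁ b₂) u v = cong₂ _,_ (aff-inverseʳ n₁ b₁ u) (aff-inverseʳ n₂ b₂ v)
cellMap-inverse (isom true  n₁ n₂ b₁ b₂) u v = cong₂ _,_ (aff-inverseʳ n₁ b₁ u) (aff-inverseʳ n₂ b₂ v)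

InG1-inverse : ∀ {P t r} → InG1 P t r → InG1 P (inverse t) r
InG1-inverse {P} {t} {r} t-symmetry u v = begin
  at P p                                ≡⟨ xor-cancelʳ (at P p) k ⟨
  (at P p xor k) xor k                  ≡⟨ cong (_xor k) P[p]⊕k≡P[u,v] ⟩
  P u v xor k                           ≡⟨ xor-assoc (P u v) (isSwap t) r ⟨
  (P u v xor isSwap t) xor r            ≡⟨ cong (λ s → (P u v xor s) xor r) (isSwap-inverse t) ⟨
  (P u v xor isSwap (inverse t)) xor r  ∎
  where
  open ≡-Reasoning
  p : ℤ × ℤ
  p = cellMap (inverse t) u v
  k : Bool
  k = isSwap t xor r
  P[p]⊕k≡P[u,v] : at P p xor k ≡ P u v
  P[p]⊕k≡P[u,v] = begin
    at P p xor k                  ≡⟨ xor-assoc (at P p) (isSwap t) r ⟨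
    (at P p xor isSwap t) xor r   ≡⟨ t-symmetry (proj₁ p) (proj₂ p) ⟨
    at P (uncurry (cellMap t) p)  ≡⟨ cong (at P) (cellMap-inverse t u v) ⟩
    P u v                         ∎

ColourEquivalencePreserving : (Strand → ℕ) → Isom → Set
ColourEquivalencePreserving col t = ∀ s s′ → col s ≡ col s′ ⇔ col (strandMap t s) ≡ col (strandMap t s′)

colourSymmetry-preserves : ∀ {col t} → ColourSymmetry col t →
                           ∀ s s′ → col s ≡ col s′ → col (strandMap t s) ≡ col (strandMap t s′)
colourSymmetry-preserves {col} symmetric s s′ cols≡cols′ =
  let (_ , to-k′) = symmetric (col s) in trans (to-k′ s refl) (sym (to-k′ s′ (sym cols≡cols′)))

perfect-preserving : ∀ {F col t r} → Perfect F col → InG1 F t r → ColourEquivalencePreserving col t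
perfect-preserving {F} {col} {t} {r} perfect t-symmetry s s′ = mk⇔
  (colourSymmetry-preserves (perfect t r t-symmetry) s s′)
  (λ cols≡cols′ → subst₂ (λ a b → col a ≡ col b) (strandMap-inverse t s) (strandMap-inverse t s′)
    (colourSymmetry-preserves (perfect (inverse t) r (InG1-inverse {F} t-symmetry)) _ _ cols≡cols′))

redundantCells-invariant : ∀ {wc wf} t → ColourEquivalencePreserving (colour wc wf) t →
                           ∀ i j → at (redundantCells wc wf) (cellMap t i j) ≡ redundantCells wc wf i j
redundantCells-invariant (isom false _ _ _ _) preserving i j =
  sym (⌊≟⌋-cong (preserving (warp i) (weft j)))
redundantCells-invariant (isom true  _ _ _ _) preserving i j =
  sym (⌊≟⌋-cong (⇔-trans (mk⇔ sym sym) (preserving (weft j) (warp i))))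

redundantCells-symmetry : ∀ {wc wf} t → ColourEquivalencePreserving (colour wc wf) t →
                          InG1 (redundantCells wc wf) t (isSwap t)
redundantCells-symmetry t preserving i j =
  trans (redundantCells-invariant t preserving i j) (sym (xor-cancelʳ _ (isSwap t)))

redundantCells-isonemal : ∀ {c F wc wf} → 0 < c → ThinStriping c wc → ThinStriping c wf →
                          Isonemal F → Perfect F (colour wc wf) → Isonemal (redundantCells wc wf)
redundantCells-isonemal {c} {F} 0<c wc-striped wf-striped (_ , transitive) perfect =
  (c , 0<c , redundantCells-periodic wc-striped wf-striped) , λ s s′ →
    let (t , r , t-symmetry , ts≡s′) = transitive s s′ in
    t , isSwap t , redundantCells-symmetry t (perfect-preserving {F} {t = t} perfect t-symmetry) , ts≡s′

-- Doubling

halved : (ℤ → Bool) → ℤ → Bool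
halved ρ = ρ ∘ halve

consecutive-periods : ∀ {ρ q} → ρ HasPeriod q → ρ HasPeriod (suc q) → ρ HasPeriod 1
consecutive-periods {ρ} {q} per per′ x = begin
  ρ (x ⊕ + 1)              ≡⟨ cong ρ (x+1≡[x-q]+[1+q] x (+ q)) ⟩
  ρ ((x - + q) ⊕ + suc q)  ≡⟨ per′ (x - + q) ⟩
  ρ (x - + q)              ≡⟨ per (x - + q) ⟨
  ρ ((x - + q) ⊕ + q)      ≡⟨ cong ρ ([x-q]+q≡x x (+ q)) ⟩
  ρ x                      ∎
  where
  open ≡-Reasoning
  x+1≡[x-q]+[1+q] : ∀ x q → x ⊕ + 1 ≡ (x - q) ⊕ (+ 1 ⊕ q)
  x+1≡[x-q]+[1+q] = solve-∀
  [x-q]+q≡x : ∀ x q → (x - q) ⊕ q ≡ x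
  [x-q]+q≡x = solve-∀

halved-period : ∀ {ρ n} → ρ HasPeriod n → halved ρ HasPeriod (2 * n)
halved-period {ρ} {n} per y = begin
  ρ (halve (y ⊕ + (2 * n)))  ≡⟨ cong (ρ ∘ halve) y+2n≡2n+y ⟩
  ρ (halve (+ 2 ⊗ + n ⊕ y))  ≡⟨ cong ρ (halve-shift (+ n) y) ⟩
  ρ (+ n ⊕ halve y)          ≡⟨ cong ρ (ℤ.+-comm (+ n) (halve y)) ⟩
  ρ (halve y ⊕ + n)          ≡⟨ per (halve y) ⟩
  ρ (halve y)                ∎
  where
  open ≡-Reasoning
  y+2n≡2n+y : y ⊕ + (2 * n) ≡ + 2 ⊗ + n ⊕ y
  y+2n≡2n+y = trans (cong (y ⊕_) (ℤ.pos-* 2 n)) (ℤ.+-comm y (+ 2 ⊗ + n))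

halved-period-even : ∀ {ρ} q → halved ρ HasPeriod (q * 2) → ρ HasPeriod q
halved-period-even {ρ} q per x = begin
  ρ (x ⊕ + q)                      ≡⟨ cong ρ (halve-even (x ⊕ + q)) ⟨
  ρ (halve (+ 2 ⊗ (x ⊕ + q)))      ≡⟨ cong (ρ ∘ halve) 2[x+q]≡2x+2q ⟩
  ρ (halve (+ 2 ⊗ x ⊕ + (q * 2)))  ≡⟨ per (+ 2 ⊗ x) ⟩
  ρ (halve (+ 2 ⊗ x))              ≡⟨ cong ρ (halve-even x) ⟩
  ρ x                              ∎
  where
  open ≡-Reasoning
  2[x+q]≡2x+q*2 : ∀ x q → + 2 ⊗ (x ⊕ q) ≡ + 2 ⊗ x ⊕ q ⊗ + 2
  2[x+q]≡2x+q*2 = solve-∀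
  2[x+q]≡2x+2q : + 2 ⊗ (x ⊕ + q) ≡ + 2 ⊗ x ⊕ + (q * 2)
  2[x+q]≡2x+2q = trans (2[x+q]≡2x+q*2 x (+ q)) (cong (+ 2 ⊗ x ⊕_) (sym (ℤ.pos-* q 2)))

halved-period-odd : ∀ {ρ} q → halved ρ HasPeriod (suc (q * 2)) → ρ HasPeriod q × ρ HasPeriod (suc q)
halved-period-odd {ρ} q per = q-period , suc-q-period
  where
  open ≡-Reasoning
  1+2q≡1+q*2 : + suc (q * 2) ≡ + 1 ⊕ + q ⊗ + 2
  1+2q≡1+q*2 = cong (+ 1 ⊕_) (ℤ.pos-* q 2)
  2[x+q]+1≡2x+[1+q*2] : ∀ x q → + 2 ⊗ (x ⊕ q) ⊕ + 1 ≡ + 2 ⊗ x ⊕ (+ 1 ⊕ q ⊗ + 2)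
  2[x+q]+1≡2x+[1+q*2] = solve-∀
  2[x+[1+q]]≡[2x+1]+[1+q*2] : ∀ x q → + 2 ⊗ (x ⊕ (+ 1 ⊕ q)) ≡ (+ 2 ⊗ x ⊕ + 1) ⊕ (+ 1 ⊕ q ⊗ + 2)
  2[x+[1+q]]≡[2x+1]+[1+q*2] = solve-∀
  2[x+q]+1≡2x+[1+2q] : ∀ x → + 2 ⊗ (x ⊕ + q) ⊕ + 1 ≡ + 2 ⊗ x ⊕ + suc (q * 2)
  2[x+q]+1≡2x+[1+2q] x = trans (2[x+q]+1≡2x+[1+q*2] x (+ q)) (cong (+ 2 ⊗ x ⊕_) (sym 1+2q≡1+q*2))
  2[x+[1+q]]≡[2x+1]+[1+2q] : ∀ x → + 2 ⊗ (x ⊕ + suc q) ≡ (+ 2 ⊗ x ⊕ + 1) ⊕ + suc (q * 2)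
  2[x+[1+q]]≡[2x+1]+[1+2q] x =
    trans (2[x+[1+q]]≡[2x+1]+[1+q*2] x (+ q)) (cong (+ 2 ⊗ x ⊕ + 1 ⊕_) (sym 1+2q≡1+q*2))
  q-period : ρ HasPeriod q
  q-period x = begin
    ρ (x ⊕ + q)                                ≡⟨ cong ρ (halve-odd (x ⊕ + q)) ⟨
    ρ (halve (+ 2 ⊗ (x ⊕ + q) ⊕ + 1))          ≡⟨ cong (ρ ∘ halve) (2[x+q]+1≡2x+[1+2q] x) ⟩
    ρ (halve (+ 2 ⊗ x ⊕ + suc (q * 2)))        ≡⟨ per (+ 2 ⊗ x) ⟩
    ρ (halve (+ 2 ⊗ x))                        ≡⟨ cong ρ (halve-even x) ⟩
    ρ x                                        ∎
  suc-q-period : ρ HasPeriod (suc q)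
  suc-q-period x = begin
    ρ (x ⊕ + suc q)                            ≡⟨ cong ρ (halve-even (x ⊕ + suc q)) ⟨
    ρ (halve (+ 2 ⊗ (x ⊕ + suc q)))            ≡⟨ cong (ρ ∘ halve) (2[x+[1+q]]≡[2x+1]+[1+2q] x) ⟩
    ρ (halve (+ 2 ⊗ x ⊕ + 1 ⊕ + suc (q * 2)))  ≡⟨ per (+ 2 ⊗ x ⊕ + 1) ⟩
    ρ (halve (+ 2 ⊗ x ⊕ + 1))                  ≡⟨ cong ρ (halve-odd x) ⟩
    ρ x                                        ∎

count-halved : ∀ ρ b n → count (halved ρ) (+ 2 ⊗ b) (n + n) ≡ count ρ b n + count ρ b n
count-halved ρ b zero    = refl
count-halved ρ b (suc m) rewrite ℕ.+-suc m m = begin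
  b2n (ρ (halve (+ 2 ⊗ b ⊕ + suc (m + m)))) + (b2n (ρ (halve (+ 2 ⊗ b ⊕ + (m + m)))) + rest)
    ≡⟨ cong₂ (λ u v → b2n (ρ u) + (b2n (ρ v) + rest)) odd-cell even-cell ⟩
  x + (x + rest)
    ≡⟨ cong (λ n → x + (x + n)) (count-halved ρ b m) ⟩
  x + (x + (count ρ b m + count ρ b m))
    ≡⟨ x+[x+[c+c]]≡[x+c]+[x+c] x (count ρ b m) ⟩
  count ρ b (suc m) + count ρ b (suc m)
    ∎
  where
  open ≡-Reasoning
  rest : ℕ
  rest = count (halved ρ) (+ 2 ⊗ b) (m + m)
  x : ℕ
  x = b2n (ρ (b ⊕ + m))
  2b+[m+m]≡2[b+m] : ∀ b m → + 2 ⊗ b ⊕ (m ⊕ m) ≡ + 2 ⊗ (b ⊕ m)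
  2b+[m+m]≡2[b+m] = solve-∀
  a+[1+n]≡[a+n]+1 : ∀ a n → a ⊕ (+ 1 ⊕ n) ≡ a ⊕ n ⊕ + 1
  a+[1+n]≡[a+n]+1 = solve-∀
  x+[x+[c+c]]≡[x+c]+[x+c] : ∀ x c → x + (x + (c + c)) ≡ (x + c) + (x + c)
  x+[x+[c+c]]≡[x+c]+[x+c] = ℕ-solve-∀
  2b+2m≡2[b+m] : + 2 ⊗ b ⊕ + (m + m) ≡ + 2 ⊗ (b ⊕ + m)
  2b+2m≡2[b+m] = trans (cong (+ 2 ⊗ b ⊕_) (ℤ.pos-+ m m)) (2b+[m+m]≡2[b+m] b (+ m))
  even-cell : halve (+ 2 ⊗ b ⊕ + (m + m)) ≡ b ⊕ + m
  even-cell = trans (cong halve 2b+2m≡2[b+m]) (halve-even (b ⊕ + m))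
  odd-cell : halve (+ 2 ⊗ b ⊕ + suc (m + m)) ≡ b ⊕ + m
  odd-cell = trans
    (cong halve (trans (a+[1+n]≡[a+n]+1 (+ 2 ⊗ b) (+ (m + m))) (cong (_⊕ + 1) 2b+2m≡2[b+m])))
    (halve-odd (b ⊕ + m))

halved-count : ∀ {ρ n d} → (∀ j → count ρ j n ≡ d) → ∀ j → count (halved ρ) j (2 * n) ≡ d + d
halved-count {ρ} {n} {d} count≡d j = begin
  count (halved ρ) j (2 * n)            ≡⟨ count-shift-invariant halved-periodic j (+ 0) ⟩
  count (halved ρ) (+ 0) (2 * n)        ≡⟨ cong (count (halved ρ) (+ 0) ∘ _+_ n) (ℕ.+-identityʳ n) ⟩
  count (halved ρ) (+ 2 ⊗ + 0) (n + n)  ≡⟨ count-halved ρ (+ 0) n ⟩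
  count ρ (+ 0) n + count ρ (+ 0) n     ≡⟨ cong₂ _+_ (count≡d (+ 0)) (count≡d (+ 0)) ⟩
  d + d                                 ∎
  where
  open ≡-Reasoning
  halved-periodic : halved ρ HasPeriod (2 * n)
  halved-periodic = halved-period (constant-count⇒period {ρ} {n} count≡d)

double-darkPer : ∀ {E d n} → DarkPer E d n → DarkPer (double E) (d + d) (2 * n)
double-darkPer {E} {d} {n} dark = darkPer {P = double E} {n = 2 * n}
  (λ i → halved-count {n = n} (darkPer-rows {E} {d} {n} dark (halve i)))
  (λ j → halved-count {n = n} (darkPer-cols {E} {d} {n} dark (halve j)))

double-periodicWith : ∀ {E n} → PeriodicWith E n → PeriodicWith (double E) (2 * n)
double-periodicWith per = periodicWith
  (λ i → halved-period (periodicWith-rows per (halve i)))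
  (λ j → halved-period (periodicWith-cols per (halve j)))

double-rows : ∀ {E m} → PeriodicWith (double E) m → ∀ a → halved (E a) HasPeriod m
double-rows {E} per a =
  subst (λ x → halved (E x) HasPeriod _) (halve-even a) (periodicWith-rows per (+ 2 ⊗ a))

double-cols : ∀ {E m} → PeriodicWith (double E) m → ∀ b → halved (flip E b) HasPeriod m
double-cols {E} per b =
  subst (λ y → halved (flip E y) HasPeriod _) (halve-even b) (periodicWith-cols per (+ 2 ⊗ b))

double-hasOrder : ∀ {E c} → 2 ≤ c → HasOrder E c → HasOrder (double E) (2 * c)
double-hasOrder {E} {c} 2≤c (s≤s z≤n , per , minimal) = s≤s z≤n , double-periodicWith per , no-shorter
  where
  no-shorter : ∀ m → 0 < m → m < 2 * c → ¬ PeriodicWith (double E) m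
  no-shorter m 0<m m<2c per′ with ℕparity m
  ... | even zero    = ℕ.<-irrefl refl 0<m
  ... | even (suc q) = minimal (suc q) (s≤s z≤n)
    (ℕ.*-cancelʳ-< 2 (suc q) c (subst (suc q * 2 <_) (ℕ.*-comm 2 c) m<2c))
    (periodicWith (halved-period-even (suc q) ∘ double-rows {E} per′)
                  (halved-period-even (suc q) ∘ double-cols {E} per′))
  ... | odd q        = minimal 1 (s≤s z≤n) 2≤c
    (periodicWith (uncurry consecutive-periods ∘ halved-period-odd q ∘ double-rows {E} per′)
                  (uncurry consecutive-periods ∘ halved-period-odd q ∘ double-cols {E} per′))

-- Thick striping

onPairs : (ℤ → ℕ) → ℤ → ℕ
onPairs f a = f (+ 2 ⊗ a)

module _ {c f} (striped : ThickStriping c f) where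

  private
    pair-colour : ∀ a → f (+ 2 ⊗ a ⊕ + 1) ≡ f (+ 2 ⊗ a)
    pair-colour = proj₁ striped
    distinct : ∀ a k → 0 < k → k < c → f (+ 2 ⊗ a ⊕ + (2 * k)) ≢ f (+ 2 ⊗ a)
    distinct = proj₂ (proj₂ striped)

  thick⇒thin : ThinStriping c (onPairs f)
  thick⇒thin =
    (λ a → trans (cong f (2[a+k]≡2a+2k a c)) (proj₁ (proj₂ striped) (+ 2 ⊗ a))) ,
    (λ a k 0<k k<c → distinct a k 0<k k<c ∘ trans (sym (cong f (2[a+k]≡2a+2k a k))))
    where
    2[a+k]≡2a+2[k] : ∀ a k → + 2 ⊗ (a ⊕ k) ≡ + 2 ⊗ a ⊕ + 2 ⊗ k
    2[a+k]≡2a+2[k] = solve-∀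
    2[a+k]≡2a+2k : ∀ a k → + 2 ⊗ (a ⊕ + k) ≡ + 2 ⊗ a ⊕ + (2 * k)
    2[a+k]≡2a+2k a k = trans (2[a+k]≡2a+2[k] a (+ k)) (cong (+ 2 ⊗ a ⊕_) (sym (ℤ.pos-* 2 k)))

  thick-colour : ∀ x → f x ≡ onPairs f (halve x)
  thick-colour x with parity x
  ... | even a = cong (onPairs f) (sym (halve-even a))
  ... | odd a  = trans (pair-colour a) (cong (onPairs f) (sym (halve-odd a)))

  onPairs-colours : ∀ k → (∃ λ i → f i ≡ k) ⇔ (∃ λ a → onPairs f a ≡ k)
  onPairs-colours k = mk⇔
    (λ (i , fi≡k) → halve i , trans (sym (thick-colour i)) fi≡k)
    (λ (a , fa≡k) → + 2 ⊗ a , fa≡k)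

  adjacent-pairs-differ : 2 ≤ c → f (+ 1) ≢ f (+ 2)
  adjacent-pairs-differ 2≤c f1≡f2 =
    distinct (+ 0) 1 (s≤s z≤n) 2≤c (trans (sym f1≡f2) (pair-colour (+ 0)))

onPairs-sameColourSet : ∀ {c wc wf} → ThickStriping c wc → ThickStriping c wf → SameColourSet wc wf →
                        SameColourSet (onPairs wc) (onPairs wf)
onPairs-sameColourSet wc-striped wf-striped same k =
  ⇔-trans (⇔-sym (onPairs-colours wc-striped k)) (⇔-trans (same k) (onPairs-colours wf-striped k))

redundantCells≡double-redundantBlocks : ∀ {c wc wf} → ThickStriping c wc → ThickStriping c wf →
  ∀ x y → redundantCells wc wf x y ≡ double (redundantBlocks wc wf) x y
redundantCells≡double-redundantBlocks wc-striped wf-striped x y =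
  cong₂ (λ u v → ⌊ u ℕ.≟ v ⌋) (thick-colour wc-striped x) (thick-colour wf-striped y)

PairsPreserved : (ℤ → ℕ) → Bool → ℤ → Set
PairsPreserved h n b = ∀ a → h (aff n b (+ 2 ⊗ a)) ≡ h (aff n b (+ 2 ⊗ a ⊕ + 1))

HalvingCommutes : Bool → ℤ → ℤ → Set
HalvingCommutes n b b′ = ∀ x → halve (aff n b x) ≡ aff n b′ (halve x)

-- An offset of the wrong parity would map some pair of strands onto strands 1 and 2.
aff-halving : ∀ {c h} → 2 ≤ c → ThickStriping c h → ∀ n b → PairsPreserved h n b →
              ∃ (HalvingCommutes n b)
aff-halving 2≤c striped n b preserved with parity b
aff-halving 2≤c striped false _ preserved | even b′ = b′ , halve-shift b′
aff-halving 2≤c striped true  _ preserved | odd b′  = b′ , halve-reflect b′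
aff-halving {h = h} 2≤c striped false _ preserved | odd b′ =
  contradiction
    (trans (cong h (1≡[2b+1]+2[-b] b′)) (trans (preserved (- b′)) (cong h ([2b+1]+[2[-b]+1]≡2 b′))))
    (adjacent-pairs-differ striped 2≤c)
  where
  1≡[2b+1]+2[-b] : ∀ b → + 1 ≡ (+ 2 ⊗ b ⊕ + 1) ⊕ + 2 ⊗ (- b)
  1≡[2b+1]+2[-b] = solve-∀
  [2b+1]+[2[-b]+1]≡2 : ∀ b → (+ 2 ⊗ b ⊕ + 1) ⊕ (+ 2 ⊗ (- b) ⊕ + 1) ≡ + 2
  [2b+1]+[2[-b]+1]≡2 = solve-∀
aff-halving {h = h} 2≤c striped true  _ preserved | even b′ =
  contradiction
    (trans (cong h (1≡2b-[2[b-1]+1] b′)) (trans (sym (preserved (b′ - + 1))) (cong h (2b-2[b-1]≡2 b′))))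
    (adjacent-pairs-differ striped 2≤c)
  where
  1≡2b-[2[b-1]+1] : ∀ b → + 1 ≡ + 2 ⊗ b - (+ 2 ⊗ (b - + 1) ⊕ + 1)
  1≡2b-[2[b-1]+1] = solve-∀
  2b-2[b-1]≡2 : ∀ b → + 2 ⊗ b - + 2 ⊗ (b - + 1) ≡ + 2
  2b-2[b-1]≡2 = solve-∀

halveStrand : Strand → Strand
halveStrand (warp x) = warp (halve x)
halveStrand (weft y) = weft (halve y)

doubleStrand : Strand → Strand
doubleStrand (warp a) = warp (+ 2 ⊗ a)
doubleStrand (weft b) = weft (+ 2 ⊗ b)

halveStrand-doubleStrand : ∀ s → halveStrand (doubleStrand s) ≡ s
halveStrand-doubleStrand (warp a) = cong warp (halve-even a)
halveStrand-doubleStrand (weft b) = cong weft (halve-even b)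

module _ {n₁ n₂ b₁ b₂ b₁′ b₂′}
         (commutes₁ : HalvingCommutes n₁ b₁ b₁′) (commutes₂ : HalvingCommutes n₂ b₂ b₂′) where

  strandMap-halve : ∀ sw s → halveStrand (strandMap (isom sw n₁ n₂ b₁ b₂) s) ≡
                             strandMap (isom sw n₁ n₂ b₁′ b₂′) (halveStrand s)
  strandMap-halve false (warp x) = cong warp (commutes₁ x)
  strandMap-halve false (weft y) = cong weft (commutes₂ y)
  strandMap-halve true  (warp x) = cong weft (commutes₂ x)
  strandMap-halve true  (weft y) = cong warp (commutes₁ y)

  cellMap-halve : ∀ sw x y → map halve halve (cellMap (isom sw n₁ n₂ b₁ b₂) x y) ≡
                             cellMap (isom sw n₁ n₂ b₁′ b₂′) (halve x) (halve y)
  cellMap-halve false x y = cong₂ _,_ (commutes₁ x) (commutes₂ y)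
  cellMap-halve true  x y = cong₂ _,_ (commutes₁ y) (commutes₂ x)

isom-pairsPreserved : ∀ {c wc wf} sw n₁ n₂ b₁ b₂ → ThickStriping c wc → ThickStriping c wf →
  ColourEquivalencePreserving (colour wc wf) (isom sw n₁ n₂ b₁ b₂) →
  PairsPreserved wc n₁ b₁ × PairsPreserved wf n₂ b₂
isom-pairsPreserved false n₁ n₂ b₁ b₂ wc-striped wf-striped preserving =
  (λ a → to (preserving (warp (+ 2 ⊗ a)) (warp (+ 2 ⊗ a ⊕ + 1))) (sym (proj₁ wc-striped a))) ,
  (λ a → to (preserving (weft (+ 2 ⊗ a)) (weft (+ 2 ⊗ a ⊕ + 1))) (sym (proj₁ wf-striped a)))
isom-pairsPreserved true  n₁ n₂ b₁ b₂ wc-striped wf-striped preserving =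
  (λ a → to (preserving (weft (+ 2 ⊗ a)) (weft (+ 2 ⊗ a ⊕ + 1))) (sym (proj₁ wf-striped a))) ,
  (λ a → to (preserving (warp (+ 2 ⊗ a)) (warp (+ 2 ⊗ a ⊕ + 1))) (sym (proj₁ wc-striped a)))

redundantBlocks-symmetry : ∀ {c wc wf} → 2 ≤ c → ThickStriping c wc → ThickStriping c wf →
  ∀ t → ColourEquivalencePreserving (colour wc wf) t →
  ∃ λ t′ → InG1 (redundantBlocks wc wf) t′ (isSwap t′)
         × (∀ s → strandMap t′ (halveStrand s) ≡ halveStrand (strandMap t s))
redundantBlocks-symmetry {wc = wc} {wf} 2≤c wc-striped wf-striped t@(isom sw n₁ n₂ b₁ b₂) preserving =
  t′ , t′-symmetry , λ s → sym (strandMap-halve commutes₁ commutes₂ sw s)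
  where
  pairs : PairsPreserved wc n₁ b₁ × PairsPreserved wf n₂ b₂
  pairs = isom-pairsPreserved sw n₁ n₂ b₁ b₂ wc-striped wf-striped preserving
  halving₁ : ∃ (HalvingCommutes n₁ b₁)
  halving₁ = aff-halving 2≤c wc-striped n₁ b₁ (proj₁ pairs)
  halving₂ : ∃ (HalvingCommutes n₂ b₂)
  halving₂ = aff-halving 2≤c wf-striped n₂ b₂ (proj₂ pairs)
  commutes₁ : HalvingCommutes n₁ b₁ (proj₁ halving₁)
  commutes₁ = proj₂ halving₁
  commutes₂ : HalvingCommutes n₂ b₂ (proj₁ halving₂)
  commutes₂ = proj₂ halving₂
  t′ : Isom
  t′ = isom sw n₁ n₂ (proj₁ halving₁) (proj₁ halving₂)
  R B : Prefabric
  R = redundantCells wc wf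
  B = redundantBlocks wc wf
  R≡double-B : ∀ x y → R x y ≡ double B x y
  R≡double-B = redundantCells≡double-redundantBlocks wc-striped wf-striped
  t′-symmetry : InG1 B t′ sw
  t′-symmetry a b = begin
    at B (cellMap t′ a b)
      ≡⟨ cong₂ (λ x y → at B (cellMap t′ x y)) (halve-even a) (halve-even b) ⟨
    at B (cellMap t′ (halve (+ 2 ⊗ a)) (halve (+ 2 ⊗ b)))
      ≡⟨ cong (at B) (cellMap-halve commutes₁ commutes₂ sw (+ 2 ⊗ a) (+ 2 ⊗ b)) ⟨
    at B (map halve halve (cellMap t (+ 2 ⊗ a) (+ 2 ⊗ b)))
      ≡⟨ R≡double-B _ _ ⟨
    at R (cellMap t (+ 2 ⊗ a) (+ 2 ⊗ b))
      ≡⟨ redundantCells-invariant t preserving (+ 2 ⊗ a) (+ 2 ⊗ b) ⟩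
    R (+ 2 ⊗ a) (+ 2 ⊗ b)
      ≡⟨ R≡double-B (+ 2 ⊗ a) (+ 2 ⊗ b) ⟩
    B (halve (+ 2 ⊗ a)) (halve (+ 2 ⊗ b))
      ≡⟨ cong₂ B (halve-even a) (halve-even b) ⟩
    B a b
      ≡⟨ xor-cancelʳ (B a b) sw ⟨
    (B a b xor sw) xor sw
      ∎
    where open ≡-Reasoning

redundantBlocks-isonemal : ∀ {c F wc wf} → 2 ≤ c → ThickStriping c wc → ThickStriping c wf →
                           Isonemal F → Perfect F (colour wc wf) → Isonemal (redundantBlocks wc wf)
redundantBlocks-isonemal {c} {F} 2≤c wc-striped wf-striped (_ , transitive) perfect =
  (c , ℕ.≤-trans (s≤s z≤n) 2≤c ,
   redundantCells-periodic (thick⇒thin wc-striped) (thick⇒thin wf-striped)) ,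
  λ s s′ →
    let (t , r , t-symmetry , ts≡s′) = transitive (doubleStrand s) (doubleStrand s′)
        (t′ , t′-symmetry , t′-halves-t) =
          redundantBlocks-symmetry 2≤c wc-striped wf-striped t
            (perfect-preserving {F} {t = t} perfect t-symmetry)
    in t′ , isSwap t′ , t′-symmetry , (begin
      strandMap t′ s                               ≡⟨ cong (strandMap t′) (halveStrand-doubleStrand s) ⟨
      strandMap t′ (halveStrand (doubleStrand s))  ≡⟨ t′-halves-t (doubleStrand s) ⟩
      halveStrand (strandMap t (doubleStrand s))   ≡⟨ cong halveStrand ts≡s′ ⟩
      halveStrand (doubleStrand s′)                ≡⟨ halveStrand-doubleStrand s′ ⟩
      s′                                           ∎)
  where open ≡-Reasoning

lemma6 : (c : ℕ) → 2 ≤ c →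
    ((F : Prefabric) (wc wf : ℤ → ℕ) →
      Fabric F → Isonemal F →
      ThinStriping c wc → ThinStriping c wf → SameColourSet wc wf →
      Perfect F (colour wc wf) →
      Fabric (redundantCells wc wf) × Isonemal (redundantCells wc wf)
      × HasOrder (redundantCells wc wf) c × DarkPer (redundantCells wc wf) 1 c)
    ×
    ((F : Prefabric) (wc wf : ℤ → ℕ) →
      Fabric F → Isonemal F →
      ThickStriping c wc → ThickStriping c wf → SameColourSet wc wf →
      Perfect F (colour wc wf) →
      Fabric (redundantBlocks wc wf) × Isonemal (redundantBlocks wc wf)
      × HasOrder (redundantBlocks wc wf) c × DarkPer (redundantBlocks wc wf) 1 c
      × HasOrder (double (redundantBlocks wc wf)) (2 * c)
      × DarkPer (double (redundantBlocks wc wf)) 2 (2 * c))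
lemma6 c 2≤c =
  (λ _ wc wf _ isonemal wc-striped wf-striped same perfect →
    redundantCells-fabric (thin-adjacent-differ 2≤c wc-striped) same ,
    redundantCells-isonemal 0<c wc-striped wf-striped isonemal perfect ,
    redundantCells-hasOrder wc-striped wf-striped 0<c same ,
    redundantCells-darkPer wc-striped wf-striped 0<c same) ,
  (λ _ wc wf _ isonemal wc-striped wf-striped same perfect →
    let wc-pairs = thick⇒thin wc-striped
        wf-pairs = thick⇒thin wf-striped
        same′    = onPairs-sameColourSet wc-striped wf-striped same
        order    = redundantCells-hasOrder wc-pairs wf-pairs 0<c same′
        dark     = redundantCells-darkPer wc-pairs wf-pairs 0<c same′
    in redundantCells-fabric (thin-adjacent-differ 2≤c wc-pairs) same′ ,
       redundantBlocks-isonemal 2≤c wc-striped wf-striped isonemal perfect ,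
       order , dark , double-hasOrder 2≤c order , double-darkPer {n = c} dark)
  where
  0<c : 0 < c
  0<c = ℕ.≤-trans (s≤s z≤n) 2≤c
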